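{- Let $k\ge 2$ and $n\ge 1$. Let $j,j'\in\{1,\dots,k\}$ and $x,x'\in\{1,\dots,k^{n-1}\}$ with $(j,x)\prec(j',x')$, i.e. $j\le j'$, $x\le x'$ and $(j,x)\neq(j',x')$. Then for any firing strategy, the chip that lands at $(j,x)$ is smaller than the chip that lands at $(j',x')$: $c_{(j,x)}<c_{(j',x')}$.
   Context: The infinite rooted directed $k$-ary tree: every vertex has $k$ children ordered from leftmost (1st) to rightmost ($k$th). Labeled chip-firing: initially chips labeled $1,\dots,k^n$ are on the root; a vertex holding at least $k$ chips may fire by choosing any $k$ of its chips and sending the chip with the $r$-th smallest label to its $r$-th leftmost child ($r=1,\dots,k$); a firing strategy is any sequence of such choices. The root fires exactly $k^{n-1}$ times, so exactly $k^{n-1}$ chips arrive at each child of the root. For $j\in\{1,\dots,k\}$ and $1\le x\le k^{n-1}$, the landing order $(j,x)$ (on layer 2) is occupied, under a given strategy, by the chip $c_{(j,x)}$, the $x$-th smallest of the chips that arrive at the $j$-th leftmost child of the root. -}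

module Defs where

open import Data.Nat using (ℕ; zero; suc; _^_; _≤_; _<_)
open import Data.Nat.Properties using (≤-decTotalOrder)
open import Data.Fin using (Fin; toℕ)
open import Data.List using (List; []; _∷_; map; allFin)
open import Data.List.Sort ≤-decTotalOrder using (sort)
open import Data.Product using (_×_)
open import Relation.Binary.PropositionalEquality using (_≡_)

-- A root firing sequence for chips 1..k^n (n = suc m):
-- the root fires exactly k^m times; in firing t (0-based, in time order) the
-- chosen k chips, listed in increasing order, are  fire t 0 < ... < fire t (k-1);
-- the chip with the r-th smallest label goes to the r-th leftmost child (r 0-based).
record RootFirings (k m : ℕ) : Set where
  field
    fire       : Fin (k ^ m) → Fin k → ℕ
    label-pos  : ∀ t r → 1 ≤ fire t r
    label-bnd  : ∀ t r → fire t r ≤ k ^ suc m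
    increasing : ∀ t r r' → toℕ r < toℕ r' → fire t r < fire t r'
    -- a chip leaves the root at most once (only chips still at the root are chosen)
    distinct   : ∀ t r t' r' → fire t r ≡ fire t' r' → (t ≡ t') × (r ≡ r')
open RootFirings public

-- nth element of a list (0-based), default 0 when out of range
nth : List ℕ → ℕ → ℕ
nth []       _       = 0
nth (a ∷ as) zero    = a
nth (a ∷ as) (suc i) = nth as i

arrivals : ∀ {k m} → RootFirings k m → Fin k → List ℕ
arrivals F j = map (λ t → fire F t j) (allFin _)

-- chip c_(j,x): the x-th smallest chip arriving at child j (x 0-based here)
landing : ∀ {k m} → RootFirings k m → Fin k → Fin (k ^ m) → ℕ
landing F j x = nth (sort (arrivals F j)) (toℕ x)

{-# OPTIONS --safe #-}
-- The chips reaching one child are distinct, so the sorted list of arrivals is strictly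
-- increasing along each child.  Across children j < j', every firing sends a smaller chip
-- to j than to j', so the two arrival lists are pointwise ordered, and sorting preserves
-- pointwise domination: if v is the x-th smallest arrival at j', then at least x + 1 chips
-- at j' are ≤ v, their partners at j are < v, so the x-th smallest arrival at j is < v.
module Submission where

open import Defs
open import Data.Nat using (ℕ; zero; suc; _^_; _≤_; _<_; z≤n; s≤s; _≤?_; _<?_)
open import Data.Nat.Properties
  using (≤-decTotalOrder; ≤-refl; ≤-trans; <-trans; <-≤-trans; ≤-<-trans; ≤∧≢⇒<; m≤n⇒m<n∨m≡n;
         m≤n⇒m≤1+n; n<1+n; n≮0; module ≤-Reasoning)
open import Data.Fin using (Fin; toℕ)
open import Data.Fin.Properties using (toℕ-injective; toℕ<n)
open import Data.List using ([]; _∷_; tabulate; length; filter)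
open import Data.List.Properties using (map-tabulate; length-tabulate; filter-none)
open import Data.List.Sort ≤-decTotalOrder using (sort; sort-↭; sort-↗)
open import Data.List.Relation.Unary.Linked as Linked using (Linked; []; [-]; _∷_)
open import Data.List.Relation.Unary.Linked.Properties using (Linked⇒All)
open import Data.List.Relation.Unary.All as All using (All)
open import Data.List.Relation.Unary.AllPairs using (_∷_)
open import Data.List.Relation.Unary.Unique.Propositional using (Unique)
import Data.List.Relation.Unary.Unique.Propositional.Properties as Unique
open import Data.List.Relation.Binary.Pointwise as Pointwise using (Pointwise; []; _∷_)
open import Data.List.Relation.Binary.Permutation.Propositional using (↭-sym; ↭⇒↭ₛ)
open import Data.List.Relation.Binary.Permutation.Propositional.Properties using (↭-length; filter-↭)
open import Data.List.Relation.Binary.Permutation.Setoid.Properties using (Unique-resp-↭)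
open import Data.Product using (_,_; proj₁)
open import Data.Sum using (inj₁; inj₂)
open import Function using (id)
open import Level using (Level)
open import Relation.Binary using (Rel; REL; Transitive)
open import Relation.Binary.PropositionalEquality using (_≡_; refl; sym; trans; cong; subst; subst₂; setoid)
open import Relation.Nullary using (¬_; yes; no; contradiction)
open import Relation.Unary using (Pred; Decidable)

private
  variable
    a b ℓ p q : Level
    A : Set a
    B : Set b

Linked-nth : {R : Rel ℕ ℓ} → Transitive R → ∀ {xs i i'} → Linked R xs →
             i < i' → i' < length xs → R (nth xs i) (nth xs i')
Linked-nth R-trans {_ ∷ _ ∷ _} {zero}  {suc zero}     (r ∷ _)  _ _ = r
Linked-nth R-trans {_ ∷ _ ∷ _} {zero}  {suc (suc i')} (r ∷ rs) _ (s≤s i'<n) =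
  R-trans r (Linked-nth R-trans rs (s≤s z≤n) i'<n)
Linked-nth R-trans {_ ∷ _}     {suc i} {suc i'}       rs (s≤s i<i') (s≤s i'<n) =
  Linked-nth R-trans (Linked.tail rs) i<i' i'<n
Linked-nth R-trans {_ ∷ []}    {zero}  {suc _}        [-] _ (s≤s ())

nth-mono-≤ : ∀ {xs i i'} → Linked _≤_ xs → i ≤ i' → i' < length xs → nth xs i ≤ nth xs i'
nth-mono-≤ sorted i≤i' i'<n with m≤n⇒m<n∨m≡n i≤i'
... | inj₁ i<i' = Linked-nth ≤-trans sorted i<i' i'<n
... | inj₂ refl = ≤-refl

Linked-≤∧Unique⇒Linked-< : ∀ {xs} → Linked _≤_ xs → Unique xs → Linked _<_ xs
Linked-≤∧Unique⇒Linked-< []       _ = []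
Linked-≤∧Unique⇒Linked-< [-]      _ = [-]
Linked-≤∧Unique⇒Linked-< (r ∷ rs) (distinct ∷ unique) =
  ≤∧≢⇒< r (All.head distinct) ∷ Linked-≤∧Unique⇒Linked-< rs unique

module _ {P : Pred ℕ p} (P? : Decidable P) (P-down : ∀ {x y} → x ≤ y → P y → P x) where

  P-nth⇒suc≤length-filter : ∀ {xs i} → Linked _≤_ xs → i < length xs → P (nth xs i) →
                            suc i ≤ length (filter P? xs)
  P-nth⇒suc≤length-filter {x ∷ xs} {i} sorted i<n P-nth with P? x
  ... | no ¬Px = contradiction (P-down (nth-mono-≤ sorted z≤n i<n) P-nth) ¬Px
  P-nth⇒suc≤length-filter {x ∷ xs} {zero}  sorted _         _     | yes _ = s≤s z≤n
  P-nth⇒suc≤length-filter {x ∷ xs} {suc i} sorted (s≤s i<n) P-nth | yes _ =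
    s≤s (P-nth⇒suc≤length-filter (Linked.tail sorted) i<n P-nth)

  <length-filter⇒P-nth : ∀ {xs i} → Linked _≤_ xs → i < length (filter P? xs) → P (nth xs i)
  <length-filter⇒P-nth {x ∷ xs} {i} sorted i<n with P? x
  ... | no ¬Px = contradiction (subst (λ ys → i < length ys) (filter-none P? none-P) i<n) n≮0
    where
    none-P : All (λ y → ¬ P y) xs
    none-P = All.tail (All.map (λ x≤y Py → ¬Px (P-down x≤y Py)) (Linked⇒All ≤-trans ≤-refl sorted))
  <length-filter⇒P-nth {x ∷ xs} {zero}  sorted _         | yes Px = Px
  <length-filter⇒P-nth {x ∷ xs} {suc i} sorted (s≤s i<n) | yes _ =
    <length-filter⇒P-nth (Linked.tail sorted) i<n

length-filter-Pointwise : {R : REL A B ℓ} {P : Pred A p} {Q : Pred B q}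
                          (P? : Decidable P) (Q? : Decidable Q) → (∀ {x y} → R x y → Q y → P x) →
                          ∀ {xs ys} → Pointwise R xs ys → length (filter Q? ys) ≤ length (filter P? xs)
length-filter-Pointwise P? Q? Q⇒P [] = z≤n
length-filter-Pointwise P? Q? Q⇒P (_∷_ {x} {y} Rxy Rxsys) with Q? y | P? x
... | yes Qy | no ¬Px = contradiction (Q⇒P Rxy Qy) ¬Px
... | yes _  | yes _  = s≤s (length-filter-Pointwise P? Q? Q⇒P Rxsys)
... | no _   | yes _  = m≤n⇒m≤1+n (length-filter-Pointwise P? Q? Q⇒P Rxsys)
... | no _   | no _   = length-filter-Pointwise P? Q? Q⇒P Rxsys

length-sort : ∀ xs → length (sort xs) ≡ length xs
length-sort xs = ↭-length (sort-↭ xs)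

length-filter-sort : {P : Pred ℕ p} (P? : Decidable P) → ∀ xs →
                     length (filter P? (sort xs)) ≡ length (filter P? xs)
length-filter-sort P? xs = ↭-length (filter-↭ P? (sort-↭ xs))

nth-sort-mono-≤ : ∀ xs {i i'} → i ≤ i' → i' < length xs → nth (sort xs) i ≤ nth (sort xs) i'
nth-sort-mono-≤ xs i≤i' i'<n = nth-mono-≤ (sort-↗ xs) i≤i' (subst (_ <_) (sym (length-sort xs)) i'<n)

nth-sort-strictMono : ∀ {xs i i'} → Unique xs → i < i' → i' < length xs →
                      nth (sort xs) i < nth (sort xs) i'
nth-sort-strictMono {xs} unique i<i' i'<n =
  Linked-nth <-trans (Linked-≤∧Unique⇒Linked-< (sort-↗ xs) unique-sorted) i<i'
             (subst (_ <_) (sym (length-sort xs)) i'<n)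
  where
  unique-sorted : Unique (sort xs)
  unique-sorted = Unique-resp-↭ (setoid ℕ) (↭⇒↭ₛ (↭-sym (sort-↭ xs))) unique

nth-sort-mono-Pointwise-< : ∀ {xs ys i} → Pointwise _<_ xs ys → i < length ys →
                            nth (sort xs) i < nth (sort ys) i
nth-sort-mono-Pointwise-< {xs} {ys} {i} xs<ys i<n =
  <length-filter⇒P-nth (_<? v) ≤-<-trans (sort-↗ xs) (begin-strict
    i                                   <⟨ n<1+n i ⟩
    suc i                               ≤⟨ P-nth⇒suc≤length-filter (_≤? v) ≤-trans (sort-↗ ys) i<|sort-ys| ≤-refl ⟩
    length (filter (_≤? v) (sort ys))   ≡⟨ length-filter-sort (_≤? v) ys ⟩
    length (filter (_≤? v) ys)          ≤⟨ length-filter-Pointwise (_<? v) (_≤? v) <-≤-trans xs<ys ⟩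
    length (filter (_<? v) xs)          ≡⟨ length-filter-sort (_<? v) xs ⟨
    length (filter (_<? v) (sort xs))   ∎)
  where
  open ≤-Reasoning
  v : ℕ
  v = nth (sort ys) i
  i<|sort-ys| : i < length (sort ys)
  i<|sort-ys| = subst (i <_) (sym (length-sort ys)) i<n

module _ {k m : ℕ} (F : RootFirings k m) where

  arrivals≡tabulate : ∀ j → arrivals F j ≡ tabulate (λ t → fire F t j)
  arrivals≡tabulate j = map-tabulate id (λ t → fire F t j)

  length-arrivals : ∀ j → length (arrivals F j) ≡ k ^ m
  length-arrivals j = trans (cong length (arrivals≡tabulate j)) (length-tabulate _)

  arrivals-unique : ∀ j → Unique (arrivals F j)
  arrivals-unique j = Unique.map⁺ (λ {t} {t'} eq → proj₁ (distinct F t j t' j eq)) (Unique.allFin⁺ _)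

  arrivals-Pointwise-< : ∀ {j j'} → toℕ j < toℕ j' → Pointwise _<_ (arrivals F j) (arrivals F j')
  arrivals-Pointwise-< {j} {j'} j<j' =
    subst₂ (Pointwise _<_) (sym (arrivals≡tabulate j)) (sym (arrivals≡tabulate j'))
           (Pointwise.tabulate⁺ (λ t → increasing F t j j' j<j'))

  order<length-arrivals : ∀ j (x : Fin (k ^ m)) → toℕ x < length (arrivals F j)
  order<length-arrivals j x = subst (toℕ x <_) (sym (length-arrivals j)) (toℕ<n x)

  landing-mono-≤ : ∀ j {x x'} → toℕ x ≤ toℕ x' → landing F j x ≤ landing F j x'
  landing-mono-≤ j {x' = x'} x≤x' = nth-sort-mono-≤ (arrivals F j) x≤x' (order<length-arrivals j x')

  landing-strictMono : ∀ j {x x'} → toℕ x < toℕ x' → landing F j x < landing F j x'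
  landing-strictMono j {x' = x'} x<x' =
    nth-sort-strictMono (arrivals-unique j) x<x' (order<length-arrivals j x')

  landing-<-child : ∀ {j j'} x → toℕ j < toℕ j' → landing F j x < landing F j' x
  landing-<-child {j' = j'} x j<j' =
    nth-sort-mono-Pointwise-< (arrivals-Pointwise-< j<j') (order<length-arrivals j' x)

proposition4p2 : (k m : ℕ) → 2 ≤ k → (F : RootFirings k m)
    → (j j' : Fin k) → (x x' : Fin (k ^ m))
    → toℕ j ≤ toℕ j' → toℕ x ≤ toℕ x' → ¬ ((j , x) ≡ (j' , x'))
    → landing F j x < landing F j' x'
proposition4p2 k m _ F j j' x x' j≤j' x≤x' jx≢j'x' with m≤n⇒m<n∨m≡n j≤j'
... | inj₁ j<j' = <-≤-trans (landing-<-child F x j<j') (landing-mono-≤ F j' x≤x')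
... | inj₂ j≡j' with toℕ-injective j≡j'
...   | refl =
  landing-strictMono F j (≤∧≢⇒< x≤x' (λ x≡x' → jx≢j'x' (cong (j ,_) (toℕ-injective x≡x'))))
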